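{- Let $A\in\mathbb{Z}^{m\times n}$, $\bm{b}\in\mathbb{Z}^m$, $\bm{c}\in\mathbb{Z}^n$, and let $A_{\max}\coloneqq\max_{i=1,\ldots,n}\|A_i\|_1$ be the largest $1$-norm of a column $A_i$ of $A$ (with $A_{\max}\geq 1$). If the integer linear program of optimizing $\bm{c}^\intercal\bm{x}$ subject to $A\bm{x}=\bm{b}$, $\bm{x}\in\mathbb{Z}^n_{\geq 0}$ is feasible and bounded (i.e., has an optimal solution), then it has an optimal solution $\bm{x}^\star$ with support size $s=|\operatorname{supp}(\bm{x}^\star)|\leq m\cdot\bigl(\log(3A_{\max})+\sqrt{\log(A_{\max})}\bigr)$.
   Context: $\log$ denotes the base-2 logarithm. For a vector $\bm{v}$, $\operatorname{supp}(\bm{v})\coloneqq\{\ell\mid v_\ell\neq 0\}$ and the support size is $|\operatorname{supp}(\bm{v})|$. -}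

module Defs where

open import Data.Nat as ℕ using (ℕ; zero; suc; _⊔_; _^_; _≤_; _<_)
open import Data.Integer as ℤ using (ℤ; ∣_∣)
open import Data.Fin using (Fin)
open import Data.Product using (Σ; _×_; ∃-syntax)
open import Relation.Binary.PropositionalEquality using (_≡_)
open import Relation.Nullary using (does)
open import Data.Bool using (if_then_else_)

sumℤ : ∀ {n} → (Fin n → ℤ) → ℤ
sumℤ {zero}  f = ℤ.0ℤ
sumℤ {suc n} f = f Fin.zero ℤ.+ sumℤ (λ i → f (Fin.suc i))
  where import Data.Fin as Fin

sumℕ : ∀ {n} → (Fin n → ℕ) → ℕ
sumℕ {zero}  f = 0
sumℕ {suc n} f = f Fin.zero ℕ.+ sumℕ (λ i → f (Fin.suc i))
  where import Data.Fin as Fin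

maxℕ : ∀ {n} → (Fin n → ℕ) → ℕ
maxℕ {zero}  f = 0
maxℕ {suc n} f = f Fin.zero ⊔ maxℕ (λ i → f (Fin.suc i))
  where import Data.Fin as Fin

Matrix : ℕ → ℕ → Set
Matrix m n = Fin m → Fin n → ℤ

mulVec : ∀ {m n} → Matrix m n → (Fin n → ℕ) → Fin m → ℤ
mulVec A x i = sumℤ (λ j → A i j ℤ.* ℤ.+ (x j))

dot : ∀ {n} → (Fin n → ℤ) → (Fin n → ℕ) → ℤ
dot c x = sumℤ (λ j → c j ℤ.* ℤ.+ (x j))

Amax : ∀ {m n} → Matrix m n → ℕ
Amax A = maxℕ (λ j → sumℕ (λ i → ∣ A i j ∣))

Feasible : ∀ {m n} → Matrix m n → (Fin m → ℤ) → (Fin n → ℕ) → Set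
Feasible A b x = ∀ i → mulVec A x i ≡ b i

Optimal : ∀ {m n} → Matrix m n → (Fin m → ℤ) → (Fin n → ℤ) → (Fin n → ℕ) → Set
Optimal A b c x = Feasible A b x × (∀ y → Feasible A b y → dot c y ℤ.≤ dot c x)

suppSize : ∀ {n} → (Fin n → ℕ) → ℕ
suppSize x = sumℕ (λ j → if does (x j ℕ.≟ 0) then 0 else 1)

-- BoundLog s m a  encodes the real inequality
--    s ≤ m · (log₂(3a) + √(log₂ a))        (for a ≥ 1)
-- exactly, using only natural-number arithmetic:
-- every rational r = r₁/r₂ with 0 ≤ r < s satisfies r < m·(p + q) for some
-- rationals p = p₁/p₂ ≥ 0 with p ≤ log₂(3a)  (⇔ 2^p₁ ≤ (3a)^p₂)
-- and q = q₁/q₂ ≥ 0 with q ≤ √(log₂ a)       (⇔ 2^(q₁²) ≤ a^(q₂²)).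
BoundLog : ℕ → ℕ → ℕ → Set
BoundLog s m a =
  ∀ r₁ r₂ → 1 ≤ r₂ → r₁ < s ℕ.* r₂ →
  ∃[ p₁ ] ∃[ p₂ ] ∃[ q₁ ] ∃[ q₂ ]
    ( 1 ≤ p₂ × 1 ≤ q₂
    × 2 ^ p₁ ≤ (3 ℕ.* a) ^ p₂
    × 2 ^ (q₁ ℕ.* q₁) ≤ a ^ (q₂ ℕ.* q₂)
    × r₁ ℕ.* p₂ ℕ.* q₂ < m ℕ.* r₂ ℕ.* (p₁ ℕ.* q₂ ℕ.+ q₁ ℕ.* p₂) )

-- Let x be an optimal solution with support S, s = |S|.  For T ⊆ S, the vector w_T with
-- (w_T)_i = Σ_{j ∈ T} (A_ij)⁺ + Σ_{j ∈ S ∖ T} (A_ij)⁻ has entries at most R_i = Σ_{j ∈ S} |A_ij|.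
-- If 2^s > ∏ (1 + R_i), two subsets T ≠ T′ give the same vector, so d = 𝟙_T - 𝟙_T′ lies in
-- the kernel of A; optimality of x forces c·d = 0, and moving from x along -d until a
-- coordinate vanishes gives an optimal solution of smaller support.  So some optimal
-- solution has 2^s ≤ ∏ (1 + R_i) ≤ ((s·A_max + m)/m)^m by AM-GM, i.e. 2^(s/m) ≤ s·A_max/m + 1.
-- Since 2^t outgrows t·a + 1 beyond t = log₂(3a) + √(log₂ a), this gives the bound; it is
-- checked with the rational approximations p/8 ≤ log₂(3a) and q/8 ≤ √(log₂ a).
module Submission where

open import Defs
open import Data.Nat using (ℕ; _≤_)
open import Data.Integer using (ℤ)
open import Data.Fin using (Fin)
open import Data.Product using (Σ; _×_; ∃-syntax)

module FiniteSums where
  open import Data.Nat as ℕ using (ℕ; zero; suc; _≤_; _<_; z≤n)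
  import Data.Nat.Properties as ℕ
  open import Data.Integer as ℤ using (ℤ; +_; -_; _+_; _*_)
  import Data.Integer.Properties as ℤ
  open import Data.Fin using (Fin; zero; suc)
  open import Function using (_∘_)
  open import Relation.Binary.PropositionalEquality
  open import Algebra.Properties.CommutativeSemigroup ℤ.+-commutativeSemigroup
    using () renaming (interchange to ℤ-interchange)
  open import Algebra.Properties.CommutativeSemigroup ℕ.+-commutativeSemigroup
    using () renaming (interchange to ℕ-interchange)

  prodℕ : ∀ {n} → (Fin n → ℕ) → ℕ
  prodℕ {zero}  f = 1
  prodℕ {suc n} f = f zero ℕ.* prodℕ (f ∘ suc)

  sumℤ-cong : ∀ {n} {f g : Fin n → ℤ} → (∀ j → f j ≡ g j) → sumℤ f ≡ sumℤ g
  sumℤ-cong {zero}  f≗g = refl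
  sumℤ-cong {suc n} f≗g = cong₂ _+_ (f≗g zero) (sumℤ-cong (f≗g ∘ suc))

  sumℤ-distrib-+ : ∀ {n} (f g : Fin n → ℤ) → sumℤ (λ j → f j + g j) ≡ sumℤ f + sumℤ g
  sumℤ-distrib-+ {zero}  f g = refl
  sumℤ-distrib-+ {suc n} f g = trans (cong (_+_ (f zero + g zero)) (sumℤ-distrib-+ (f ∘ suc) (g ∘ suc)))
                                     (ℤ-interchange (f zero) (g zero) _ _)

  sumℤ-neg : ∀ {n} (f : Fin n → ℤ) → sumℤ (λ j → - f j) ≡ - sumℤ f
  sumℤ-neg {zero}  f = refl
  sumℤ-neg {suc n} f = trans (cong (_+_ (- f zero)) (sumℤ-neg (f ∘ suc))) (sym (ℤ.neg-distrib-+ (f zero) _))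

  sumℤ-pos : ∀ {n} (f : Fin n → ℕ) → sumℤ (λ j → + f j) ≡ + sumℕ f
  sumℤ-pos {zero}  f = refl
  sumℤ-pos {suc n} f = trans (cong (_+_ (+ f zero)) (sumℤ-pos (f ∘ suc))) (sym (ℤ.pos-+ (f zero) _))

  sumℕ-mono-≤ : ∀ {n} {f g : Fin n → ℕ} → (∀ j → f j ≤ g j) → sumℕ f ≤ sumℕ g
  sumℕ-mono-≤ {zero}  f≤g = z≤n
  sumℕ-mono-≤ {suc n} f≤g = ℕ.+-mono-≤ (f≤g zero) (sumℕ-mono-≤ (f≤g ∘ suc))

  sumℕ-mono-< : ∀ {n} {f g : Fin n → ℕ} → (∀ j → f j ≤ g j) → ∀ k → f k < g k → sumℕ f < sumℕ g
  sumℕ-mono-< {suc n} f≤g zero    fk<gk = ℕ.+-mono-<-≤ fk<gk (sumℕ-mono-≤ (f≤g ∘ suc))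
  sumℕ-mono-< {suc n} f≤g (suc k) fk<gk = ℕ.+-mono-≤-< (f≤g zero) (sumℕ-mono-< (f≤g ∘ suc) k fk<gk)

  sumℕ-zero : ∀ n → sumℕ {n} (λ _ → 0) ≡ 0
  sumℕ-zero zero    = refl
  sumℕ-zero (suc n) = sumℕ-zero n

  sumℕ-distrib-+ : ∀ {n} (f g : Fin n → ℕ) → sumℕ (λ j → f j ℕ.+ g j) ≡ sumℕ f ℕ.+ sumℕ g
  sumℕ-distrib-+ {zero}  f g = refl
  sumℕ-distrib-+ {suc n} f g = trans (cong (f zero ℕ.+ g zero ℕ.+_) (sumℕ-distrib-+ (f ∘ suc) (g ∘ suc)))
                                     (ℕ-interchange (f zero) (g zero) _ _)

  sumℕ-comm : ∀ {m n} (f : Fin m → Fin n → ℕ) → sumℕ (λ i → sumℕ (f i)) ≡ sumℕ (λ j → sumℕ (λ i → f i j))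
  sumℕ-comm {zero}  {n} f = sym (sumℕ-zero n)
  sumℕ-comm {suc m} {n} f = trans (cong (sumℕ (f zero) ℕ.+_) (sumℕ-comm (f ∘ suc)))
                                  (sym (sumℕ-distrib-+ (f zero) (λ j → sumℕ (λ i → f (suc i) j))))

  sumℕ-distribʳ-* : ∀ {n} (f : Fin n → ℕ) a → sumℕ (λ j → f j ℕ.* a) ≡ sumℕ f ℕ.* a
  sumℕ-distribʳ-* {zero}  f a = refl
  sumℕ-distribʳ-* {suc n} f a = trans (cong (f zero ℕ.* a ℕ.+_) (sumℕ-distribʳ-* (f ∘ suc) a))
                                      (sym (ℕ.*-distribʳ-+ a (f zero) _))

  sumℕ-suc : ∀ {n} (f : Fin n → ℕ) → sumℕ (λ j → suc (f j)) ≡ sumℕ f ℕ.+ n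
  sumℕ-suc {zero}  f = refl
  sumℕ-suc {suc n} f = trans (cong (λ s → suc (f zero ℕ.+ s)) (sumℕ-suc (f ∘ suc)))
                             (trans (cong suc (sym (ℕ.+-assoc (f zero) _ n))) (sym (ℕ.+-suc _ n)))

  ≤-maxℕ : ∀ {n} (f : Fin n → ℕ) j → f j ≤ maxℕ f
  ≤-maxℕ {suc n} f zero    = ℕ.m≤m⊔n _ _
  ≤-maxℕ {suc n} f (suc j) = ℕ.≤-trans (≤-maxℕ (f ∘ suc) j) (ℕ.m≤n⊔m _ _)

  maxℕ-zero : ∀ n → maxℕ {n} (λ _ → 0) ≡ 0
  maxℕ-zero zero    = refl
  maxℕ-zero (suc n) = maxℕ-zero n

  sumℤ-*-translate : ∀ {n} (r d : Fin n → ℤ) {x y : Fin n → ℕ} → (∀ j → + y j ≡ + x j + d j) →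
                     sumℤ (λ j → r j * + y j) ≡ sumℤ (λ j → r j * + x j) + sumℤ (λ j → r j * d j)
  sumℤ-*-translate r d {x} y≡x+d = trans (sumℤ-cong (λ j → trans (cong (r j *_) (y≡x+d j)) (ℤ.*-distribˡ-+ (r j) (+ x j) (d j))))
                                         (sumℤ-distrib-+ (λ j → r j * + x j) (λ j → r j * d j))

  sumℤ-*-neg : ∀ {n} (r d : Fin n → ℤ) → sumℤ (λ j → r j * - d j) ≡ - sumℤ (λ j → r j * d j)
  sumℤ-*-neg r d = trans (sumℤ-cong (λ j → sym (ℤ.neg-distribʳ-* (r j) (d j)))) (sumℤ-neg (λ j → r j * d j))

module Powers where
  open import Data.Nat
  open import Data.Nat.Properties
  open import Data.Nat.Tactic.RingSolver using (solve-∀)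
  open import Data.Product using (∃-syntax; _×_; _,_)
  open import Relation.Nullary using (¬_; yes; no; contradiction)
  open import Relation.Unary using (Pred; Decidable)
  open import Relation.Binary.PropositionalEquality

  ^-distribʳ-* : ∀ m n k → (m * n) ^ k ≡ m ^ k * n ^ k
  ^-distribʳ-* m n zero    = refl
  ^-distribʳ-* m n (suc k) = trans (cong (m * n *_) (^-distribʳ-* m n k)) (swap m n (m ^ k) (n ^ k))
    where
    swap : ∀ a b c d → a * b * (c * d) ≡ a * c * (b * d)
    swap = solve-∀

  ^-cancelʳ-< : ∀ b .{{_ : NonZero b}} {m n} → b ^ m < b ^ n → m < n
  ^-cancelʳ-< b {m} {n} bᵐ<bⁿ with m <? n
  ... | yes m<n = m<n
  ... | no  m≮n = contradiction (^-monoʳ-≤ b (≮⇒≥ m≮n)) (<⇒≱ bᵐ<bⁿ)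

  ^-cancelˡ-≤ : ∀ k .{{_ : NonZero k}} {m n} → m ^ k ≤ n ^ k → m ≤ n
  ^-cancelˡ-≤ k {m} {n} mᵏ≤nᵏ with m ≤? n
  ... | yes m≤n = m≤n
  ... | no  m≰n = contradiction mᵏ≤nᵏ (<⇒≱ (^-monoˡ-< k (≰⇒> m≰n)))

  n<2^n : ∀ n → n < 2 ^ n
  n<2^n zero    = z<s
  n<2^n (suc n) = subst₂ _≤_ (+-comm (suc n) 1) (cong (2 ^ n +_) (sym (+-identityʳ (2 ^ n))))
                    (+-mono-≤ (n<2^n n) (m^n>0 2 n))

  ∃-crossing : ∀ {p} (P : Pred ℕ p) → Decidable P → P 0 → ∀ b → ¬ P b → ∃[ k ] (P k × ¬ P (suc k))
  ∃-crossing P P? P0 zero    ¬Pb = contradiction P0 ¬Pb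
  ∃-crossing P P? P0 (suc b) ¬Pb with P? b
  ... | yes Pb = b , Pb , ¬Pb
  ... | no ¬Pb′ = ∃-crossing P P? P0 b ¬Pb′

  ⌊log₂⌋-spec : ∀ b .{{_ : NonZero b}} → ∃[ k ] (2 ^ k ≤ b × b < 2 ^ suc k)
  ⌊log₂⌋-spec b
    with k , lower , upper ← ∃-crossing (λ k → 2 ^ k ≤ b) (λ k → 2 ^ k ≤? b) (>-nonZero⁻¹ b) b (<⇒≱ (n<2^n b))
    = k , lower , ≰⇒> upper

  ⌊√log₂⌋-spec : ∀ b .{{_ : NonZero b}} → ∃[ k ] (2 ^ (k * k) ≤ b × b < 2 ^ (suc k * suc k))
  ⌊√log₂⌋-spec b
    with k , lower , upper ← ∃-crossing (λ k → 2 ^ (k * k) ≤ b) (λ k → 2 ^ (k * k) ≤? b) (>-nonZero⁻¹ b) b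
                               (<⇒≱ (≤-<-trans (m≤m*n b b) (n<2^n (b * b))))
    = k , lower , ≰⇒> upper

  [n+a]^k*m≤n^k*n : ∀ a n k m → m + k * a ≡ n → (n + a) ^ k * m ≤ n ^ k * n
  [n+a]^k*m≤n^k*n a n zero    m m≡n = *-monoʳ-≤ 1 (subst (m ≤_) m≡n (m≤m+n m 0))
  [n+a]^k*m≤n^k*n a n (suc k) m m+[1+k]a≡n = begin
    (n + a) * (n + a) ^ k * m      ≡⟨ e₁ (n + a) ((n + a) ^ k) m ⟩
    (n + a) ^ k * ((n + a) * m)    ≤⟨ *-monoʳ-≤ ((n + a) ^ k) [n+a]m≤[m+a]n ⟩
    (n + a) ^ k * ((m + a) * n)    ≡⟨ *-assoc ((n + a) ^ k) (m + a) n ⟨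
    (n + a) ^ k * (m + a) * n      ≤⟨ *-monoˡ-≤ n ([n+a]^k*m≤n^k*n a n k (m + a) m+a+ka≡n) ⟩
    n ^ k * n * n                  ≡⟨ cong (_* n) (*-comm (n ^ k) n) ⟩
    n * n ^ k * n                  ∎
    where
    open ≤-Reasoning
    e₁ : ∀ x y z → x * y * z ≡ y * (x * z)
    e₁ = solve-∀
    e₂ : ∀ m a k → m + a + k * a ≡ m + suc k * a
    e₂ = solve-∀
    m+a+ka≡n : m + a + k * a ≡ n
    m+a+ka≡n = trans (e₂ m a k) m+[1+k]a≡n
    [n+a]m≤[m+a]n : (n + a) * m ≤ (m + a) * n
    [n+a]m≤[m+a]n = begin
      (n + a) * m      ≡⟨ *-distribʳ-+ m n a ⟩
      n * m + a * m    ≤⟨ +-monoʳ-≤ (n * m) (*-monoʳ-≤ a (subst (m ≤_) m+[1+k]a≡n (m≤m+n m _))) ⟩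
      n * m + a * n    ≡⟨ cong (_+ a * n) (*-comm n m) ⟩
      m * n + a * n    ≡⟨ *-distribʳ-+ n m a ⟨
      (m + a) * n      ∎

  [n+a]^k≤2*n^k : ∀ a n k .{{_ : NonZero n}} → 2 * (k * a) ≤ n → (n + a) ^ k ≤ 2 * n ^ k
  [n+a]^k≤2*n^k a n k 2ka≤n = *-cancelʳ-≤ ((n + a) ^ k) (2 * n ^ k) n (begin
    (n + a) ^ k * n          ≤⟨ *-monoʳ-≤ ((n + a) ^ k) n≤2m ⟩
    (n + a) ^ k * (2 * m)    ≡⟨ e₁ ((n + a) ^ k) m ⟩
    2 * ((n + a) ^ k * m)    ≤⟨ *-monoʳ-≤ 2 ([n+a]^k*m≤n^k*n a n k m m+ka≡n) ⟩
    2 * (n ^ k * n)          ≡⟨ *-assoc 2 (n ^ k) n ⟨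
    2 * n ^ k * n            ∎)
    where
    open ≤-Reasoning
    m : ℕ
    m = n ∸ k * a
    ka+ka≤n : k * a + k * a ≤ n
    ka+ka≤n = subst (λ x → k * a + x ≤ n) (+-identityʳ (k * a)) 2ka≤n
    m+ka≡n : m + k * a ≡ n
    m+ka≡n = m∸n+n≡m (≤-trans (m≤m+n (k * a) (k * a)) ka+ka≤n)
    ka≤m : k * a ≤ m
    ka≤m = +-cancelʳ-≤ (k * a) (k * a) m (subst (k * a + k * a ≤_) (sym m+ka≡n) ka+ka≤n)
    n≤2m : n ≤ 2 * m
    n≤2m = subst₂ _≤_ m+ka≡n (cong (m +_) (sym (+-identityʳ m))) (+-monoʳ-≤ m ka≤m)
    e₁ : ∀ x y → x * (2 * y) ≡ 2 * (x * y)
    e₁ = solve-∀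

module AMGM where
  open FiniteSums using (prodℕ)
  open Powers using (^-distribʳ-*)
  open import Data.Nat
  open import Data.Nat.Properties
  open import Data.Nat.Tactic.RingSolver using (solve-∀)
  open import Data.Fin using (Fin; zero; suc)
  open import Data.Sum using (inj₁; inj₂)
  open import Function using (_∘_)
  open import Relation.Binary.PropositionalEquality

  2y[y+d]≤y²+[y+d]² : ∀ y d → 2 * y * (y + d) ≤ y * y + (y + d) * (y + d)
  2y[y+d]≤y²+[y+d]² y d = subst (2 * y * (y + d) ≤_) (sym (square-identity y d)) (m≤m+n _ (d * d))
    where
    square-identity : ∀ y d → y * y + (y + d) * (y + d) ≡ 2 * y * (y + d) + d * d
    square-identity = solve-∀

  2yz≤y²+z² : ∀ y z → 2 * y * z ≤ y * y + z * z
  2yz≤y²+z² y z with ≤-total y z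
  ... | inj₁ y≤z = subst (λ z → 2 * y * z ≤ y * y + z * z) (m+[n∸m]≡n y≤z) (2y[y+d]≤y²+[y+d]² y (z ∸ y))
  ... | inj₂ z≤y = subst₂ _≤_ (swap z y) (+-comm (z * z) (y * y))
                     (subst (λ y → 2 * z * y ≤ z * z + y * y) (m+[n∸m]≡n z≤y) (2y[y+d]≤y²+[y+d]² z (y ∸ z)))
    where
    swap : ∀ z y → 2 * z * y ≡ 2 * y * z
    swap = solve-∀

  weighted-amgm : ∀ k y z → suc k * y * z ^ k ≤ y ^ suc k + k * z ^ suc k
  weighted-amgm zero    y z = ≤-reflexive (identity y)
    where
    identity : ∀ y → 1 * y * 1 ≡ y * 1 + 0
    identity = solve-∀
  weighted-amgm (suc k) y z = +-cancelʳ-≤ (k * y * (z * zᵏ)) _ _ (begin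
    (2 + k) * y * (z * zᵏ) + k * y * (z * zᵏ)               ≡⟨ e₁ k y z zᵏ ⟩
    (1 + k) * zᵏ * (2 * y * z)                              ≤⟨ *-monoʳ-≤ ((1 + k) * zᵏ) (2yz≤y²+z² y z) ⟩
    (1 + k) * zᵏ * (y * y + z * z)                          ≡⟨ e₂ k y z zᵏ ⟩
    (1 + k) * y * zᵏ * y + (1 + k) * zᵏ * (z * z)           ≤⟨ +-monoˡ-≤ _ (*-monoˡ-≤ y (weighted-amgm k y z)) ⟩
    (y * yᵏ + k * (z * zᵏ)) * y + (1 + k) * zᵏ * (z * z)    ≡⟨ e₃ k y z yᵏ zᵏ ⟩
    y * (y * yᵏ) + (1 + k) * (z * (z * zᵏ)) + k * y * (z * zᵏ) ∎)
    where
    open ≤-Reasoning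
    yᵏ zᵏ : ℕ
    yᵏ = y ^ k
    zᵏ = z ^ k
    e₁ : ∀ k y z zᵏ → (2 + k) * y * (z * zᵏ) + k * y * (z * zᵏ) ≡ (1 + k) * zᵏ * (2 * y * z)
    e₁ = solve-∀
    e₂ : ∀ k y z zᵏ → (1 + k) * zᵏ * (y * y + z * z) ≡ (1 + k) * y * zᵏ * y + (1 + k) * zᵏ * (z * z)
    e₂ = solve-∀
    e₃ : ∀ k y z yᵏ zᵏ → (y * yᵏ + k * (z * zᵏ)) * y + (1 + k) * zᵏ * (z * z) ≡ y * (y * yᵏ) + (1 + k) * (z * (z * zᵏ)) + k * y * (z * zᵏ)
    e₃ = solve-∀

  amgm-extend : ∀ k s x .{{_ : NonZero k}} → (1 + k) ^ (1 + k) * s ^ k * x ≤ k ^ k * (s + x) ^ (1 + k)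
  amgm-extend k s x = *-cancelˡ-≤ k (+-cancelʳ-≤ (k * w) _ _ (begin
    k * ((1 + k) ^ (1 + k) * s ^ k * x) + k * w   ≡⟨ e₁ k s x cᵏ sᵏ ⟩
    (1 + k) * y * (cᵏ * sᵏ)                        ≡⟨ cong ((1 + k) * y *_) (^-distribʳ-* (1 + k) s k) ⟨
    (1 + k) * y * z ^ k                            ≤⟨ weighted-amgm k y z ⟩
    y ^ (1 + k) + k * z ^ (1 + k)                  ≡⟨ cong₂ (λ u v → u + k * (z * v)) (^-distribʳ-* k (s + x) (1 + k)) (^-distribʳ-* (1 + k) s k) ⟩
    k ^ (1 + k) * (s + x) ^ (1 + k) + k * w        ≡⟨ cong (_+ k * w) (*-assoc k (k ^ k) _) ⟩
    k * (k ^ k * (s + x) ^ (1 + k)) + k * w        ∎))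
    where
    open ≤-Reasoning
    y z cᵏ sᵏ w : ℕ
    y = k * (s + x)
    z = (1 + k) * s
    cᵏ = (1 + k) ^ k
    sᵏ = s ^ k
    w = (1 + k) * s * (cᵏ * sᵏ)
    e₁ : ∀ k s x cᵏ sᵏ → k * ((1 + k) * cᵏ * sᵏ * x) + k * ((1 + k) * s * (cᵏ * sᵏ)) ≡ (1 + k) * (k * (s + x)) * (cᵏ * sᵏ)
    e₁ = solve-∀

  amgm : ∀ k (f : Fin k → ℕ) → k ^ k * prodℕ f ≤ sumℕ f ^ k
  amgm zero            f = ≤-refl
  amgm (suc zero)      f = ≤-reflexive (identity (f zero))
    where
    identity : ∀ x → 1 * (x * 1) ≡ (x + 0) * 1
    identity = solve-∀
  amgm (suc j@(suc _)) f = *-cancelˡ-≤ (j ^ j) {{m^n≢0 j j}} (begin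
    j ^ j * (c * (x * prodℕ g))    ≡⟨ e₁ (j ^ j) c x (prodℕ g) ⟩
    c * x * (j ^ j * prodℕ g)      ≤⟨ *-monoʳ-≤ (c * x) (amgm j g) ⟩
    c * x * sumℕ g ^ j             ≡⟨ e₂ c x (sumℕ g ^ j) ⟩
    c * sumℕ g ^ j * x             ≤⟨ amgm-extend j (sumℕ g) x ⟩
    j ^ j * (sumℕ g + x) ^ (1 + j) ≡⟨ cong (λ s → j ^ j * s ^ (1 + j)) (+-comm (sumℕ g) x) ⟩
    j ^ j * (x + sumℕ g) ^ (1 + j) ∎)
    where
    open ≤-Reasoning
    x c : ℕ
    x = f zero
    c = (1 + j) ^ (1 + j)
    g : Fin j → ℕ
    g = f ∘ suc
    e₁ : ∀ a c x p → a * (c * (x * p)) ≡ c * x * (a * p)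
    e₁ = solve-∀
    e₂ : ∀ c x s → c * x * s ≡ c * s * x
    e₂ = solve-∀

module LogBound where
  open import Data.Nat
  open import Data.Nat.Properties
  open import Data.Nat.DivMod using (_/_; _%_; m/n*n≤m; m≡m%n+[m/n]*n; m%n<n)
  open import Data.Nat.Tactic.RingSolver using (solve-∀)
  open import Data.Fin using (Fin; toℕ; fromℕ<)
  open import Data.Fin.Properties using (all?; toℕ-fromℕ<)
  open import Data.Product using (_,_)
  open import Data.Unit using (tt)
  open import Relation.Nullary using (yes; no; contradiction)
  open import Relation.Nullary.Decidable using (toWitness)
  open import Relation.Binary.PropositionalEquality

  open Powers

  doubling : ∀ {x d y} .{{_ : NonZero x}} → 2 * (8 * d) ≤ x → 2 * x ^ 8 ≤ y → 2 * (x + d) ^ 8 ≤ 2 * y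
  doubling {x} {d} 16d≤x 2x⁸≤y = *-monoʳ-≤ 2 (≤-trans ([n+a]^k≤2*n^k d x 8 16d≤x) 2x⁸≤y)

  -- Opaque, so that the type checker never unfolds these into huge unary numerals.
  opaque
    C : ℕ
    C = 3 ^ 8 * 8 ^ 16

    C≡ : C ≡ 3 ^ 8 * 8 ^ 8 * 8 ^ 8
    C≡ = refl

    φ : ℕ → ℕ
    φ q = 102 + (1 + q) * (1 + q) + 8 * (q + 9)

    instance
      φ≢0 : ∀ {q} → NonZero (φ q)
      φ≢0 = _

    φ-suc : ∀ q → φ (suc q) ≡ φ q + (2 * q + 11)
    φ-suc = identity
      where
      identity : ∀ q → 102 + (2 + q) * (2 + q) + 8 * (1 + q + 9) ≡ 102 + (1 + q) * (1 + q) + 8 * (q + 9) + (2 * q + 11)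
      identity = solve-∀

    16[2q+11]≤φq : ∀ r → 2 * (8 * (2 * (r + 23) + 11)) ≤ φ (r + 23)
    16[2q+11]≤φq r = subst (2 * (8 * (2 * (r + 23) + 11)) ≤_) (sym (identity r)) (m≤m+n _ (r * r + 24 * r + 22))
      where
      identity : ∀ r → 102 + (1 + (r + 23)) * (1 + (r + 23)) + 8 * (r + 23 + 9) ≡ 2 * (8 * (2 * (r + 23) + 11)) + (r * r + 24 * r + 22)
      identity = solve-∀

    8[k+q+9]≤φq : ∀ k q → k * 8 ≤ 102 + suc q * suc q → 8 * (k + q + 9) ≤ φ q
    8[k+q+9]≤φq k q k8≤ = subst (_≤ φ q) (sym (identity k q)) (+-monoˡ-≤ (8 * (q + 9)) k8≤)
      where
      identity : ∀ k q → 8 * (k + q + 9) ≡ k * 8 + 8 * (q + 9)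
      identity = solve-∀

  -- Checked by evaluation for q < 24; from q = 23 on, φ grows by at most φ q / 16 per step,
  -- which at most doubles φ q ^ 8.
  Dominated : ℕ → Set
  Dominated q = 2 * φ q ^ 8 ≤ 2 ^ q * C

  opaque
    unfolding C φ

    dominated-small : ∀ (i : Fin 24) → Dominated (toℕ i)
    dominated-small = toWitness {a? = all? (λ i → 2 * φ (toℕ i) ^ 8 ≤? 2 ^ toℕ i * C)} tt

  dominated-large : ∀ r → Dominated (r + 23)
  dominated-large zero    = dominated-small (fromℕ< {23} ≤-refl)
  dominated-large (suc r) =
    subst₂ _≤_ (cong (λ x → 2 * x ^ 8) (sym (φ-suc (r + 23)))) (sym (*-assoc 2 (2 ^ (r + 23)) C))
      (doubling (16[2q+11]≤φq r) (dominated-large r))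

  dominated : ∀ q → Dominated q
  dominated q with q <? 24
  ... | yes q<24 = subst Dominated (toℕ-fromℕ< q<24) (dominated-small (fromℕ< q<24))
  ... | no  q≮24 = subst Dominated (m∸n+n≡m (≤-trans (n≤1+n 23) (≮⇒≥ q≮24))) (dominated-large (q ∸ 23))

  16a≤[t+1]a+8 : ∀ {a p} t → 1 ≤ a → (3 * a) ^ 8 < 2 ^ suc p → p ≤ t → 2 * (8 * a) ≤ (t + 1) * a + 8
  16a≤[t+1]a+8 {suc zero} {p} t _ 3⁸<2^[1+p] p≤t =
    subst (16 ≤_) (cong (_+ 8) (sym (*-identityʳ (t + 1))))
      (+-monoˡ-≤ 8 (≤-trans (s≤s⁻¹ 9≤1+p) (≤-trans p≤t (m≤m+n t 1))))
    where
    9≤1+p : 9 ≤ suc p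
    9≤1+p = ^-cancelʳ-< 2 (≤-<-trans (≤ᵇ⇒≤ (2 ^ 8) (3 ^ 8) tt) 3⁸<2^[1+p])
  16a≤[t+1]a+8 {a@(suc (suc _))} {p} t _ [3a]^8<2^[1+p] p≤t =
    subst (_≤ (t + 1) * a + 8) (*-assoc 2 8 a)
      (≤-trans (*-monoˡ-≤ a (≤-trans 16≤p (≤-trans p≤t (m≤m+n t 1)))) (m≤m+n ((t + 1) * a) 8))
    where
    6≤3a : 6 ≤ 3 * a
    6≤3a = *-monoʳ-≤ 3 (s≤s (s≤s z≤n))
    16≤p : 16 ≤ p
    16≤p = s≤s⁻¹ (^-cancelʳ-< 2 (≤-<-trans (≤-trans (≤ᵇ⇒≤ (2 ^ 16) (6 ^ 8) tt) (^-monoˡ-≤ 8 6≤3a)) [3a]^8<2^[1+p]))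

  -- Stated for an abstract c: instantiating c = 102 inside the proof would unfold 2 ^ 102.
  8k<c+[1+q]² : ∀ {a k q} c → 3 ^ 64 ≤ 2 ^ c → 2 ^ k ≤ (3 * a) ^ 8 → a ^ 64 < 2 ^ (suc q * suc q) →
                k * 8 < c + suc q * suc q
  8k<c+[1+q]² {a} {k} {q} c 3⁶⁴≤2ᶜ 2ᵏ≤[3a]⁸ a⁶⁴<2^[1+q]² = ^-cancelʳ-< 2 (begin-strict
    2 ^ (k * 8)                    ≡⟨ ^-*-assoc 2 k 8 ⟨
    (2 ^ k) ^ 8                    ≤⟨ ^-monoˡ-≤ 8 2ᵏ≤[3a]⁸ ⟩
    ((3 * a) ^ 8) ^ 8              ≡⟨ ^-*-assoc (3 * a) 8 8 ⟩
    (3 * a) ^ 64                   ≡⟨ ^-distribʳ-* 3 a 64 ⟩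
    3 ^ 64 * a ^ 64                <⟨ *-monoʳ-< (3 ^ 64) a⁶⁴<2^[1+q]² ⟩
    3 ^ 64 * 2 ^ (suc q * suc q)   ≤⟨ *-monoˡ-≤ (2 ^ (suc q * suc q)) 3⁶⁴≤2ᶜ ⟩
    2 ^ c * 2 ^ (suc q * suc q)    ≡⟨ ^-distribˡ-+-* 2 c (suc q * suc q) ⟨
    2 ^ (c + suc q * suc q)        ∎)
    where open ≤-Reasoning

  module Growth {a p q : ℕ} .{{_ : NonZero a}}
                (2^p≤[3a]^8 : 2 ^ p ≤ (3 * a) ^ 8)
                ([3a]^8<2^[1+p] : (3 * a) ^ 8 < 2 ^ suc p)
                (a^64<2^[1+q]² : a ^ 64 < 2 ^ (suc q * suc q)) where

    2[p+q+9]^8≤2^q*3^8*8^8 : 2 * (p + q + 9) ^ 8 ≤ 2 ^ q * (3 ^ 8 * 8 ^ 8)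
    2[p+q+9]^8≤2^q*3^8*8^8 = *-cancelʳ-≤ _ _ (8 ^ 8) {{m^n≢0 8 8}} (begin
      2 * (p + q + 9) ^ 8 * 8 ^ 8        ≡⟨ e₁ ((p + q + 9) ^ 8) (8 ^ 8) ⟩
      2 * (8 ^ 8 * (p + q + 9) ^ 8)      ≡⟨ cong (2 *_) (^-distribʳ-* 8 (p + q + 9) 8) ⟨
      2 * (8 * (p + q + 9)) ^ 8          ≤⟨ *-monoʳ-≤ 2 (^-monoˡ-≤ 8 (8[k+q+9]≤φq p q (<⇒≤ 8p<102+[1+q]²))) ⟩
      2 * φ q ^ 8                        ≤⟨ dominated q ⟩
      2 ^ q * C                          ≡⟨ cong (2 ^ q *_) C≡ ⟩
      2 ^ q * (3 ^ 8 * 8 ^ 8 * 8 ^ 8)    ≡⟨ *-assoc (2 ^ q) (3 ^ 8 * 8 ^ 8) (8 ^ 8) ⟨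
      2 ^ q * (3 ^ 8 * 8 ^ 8) * 8 ^ 8    ∎)
      where
      open ≤-Reasoning
      e₁ : ∀ x y → 2 * x * y ≡ 2 * (y * x)
      e₁ = solve-∀
      8p<102+[1+q]² : p * 8 < 102 + suc q * suc q
      8p<102+[1+q]² = 8k<c+[1+q]² {a} {p} {q} 102 (≤ᵇ⇒≤ (3 ^ 64) (2 ^ 102) tt) 2^p≤[3a]^8 a^64<2^[1+q]²

    growth-base : ((p + q + 1) * a + 8) ^ 8 < 2 ^ (p + q) * 8 ^ 8
    growth-base = *-cancelˡ-< (2 * 3 ^ 8) _ _ (begin-strict
      2 * 3 ^ 8 * x ^ 8                           ≤⟨ *-monoʳ-≤ (2 * 3 ^ 8) (^-monoˡ-≤ 8 x≤a[p+q+9]) ⟩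
      2 * 3 ^ 8 * (a * (p + q + 9)) ^ 8           ≡⟨ regroup ⟩
      (3 * a) ^ 8 * (2 * (p + q + 9) ^ 8)         ≤⟨ *-monoʳ-≤ ((3 * a) ^ 8) 2[p+q+9]^8≤2^q*3^8*8^8 ⟩
      (3 * a) ^ 8 * (2 ^ q * (3 ^ 8 * 8 ^ 8))     <⟨ *-monoˡ-< (2 ^ q * (3 ^ 8 * 8 ^ 8)) {{nonzero}} [3a]^8<2^[1+p] ⟩
      2 ^ suc p * (2 ^ q * (3 ^ 8 * 8 ^ 8))       ≡⟨ collect ⟩
      2 * 3 ^ 8 * (2 ^ (p + q) * 8 ^ 8)           ∎)
      where
      open ≤-Reasoning
      x : ℕ
      x = (p + q + 1) * a + 8
      e₁ : ∀ t a → t * a + 8 * a ≡ a * (t + 8)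
      e₁ = solve-∀
      x≤a[p+q+9] : x ≤ a * (p + q + 9)
      x≤a[p+q+9] = subst (x ≤_) (trans (e₁ (p + q + 1) a) (cong (a *_) (+-assoc (p + q) 1 8)))
                     (+-monoʳ-≤ ((p + q + 1) * a) (m≤m*n 8 a))
      e₂ : ∀ x y z → 2 * x * (y * z) ≡ x * y * (2 * z)
      e₂ = solve-∀
      regroup : 2 * 3 ^ 8 * (a * (p + q + 9)) ^ 8 ≡ (3 * a) ^ 8 * (2 * (p + q + 9) ^ 8)
      regroup = begin-equality
        2 * 3 ^ 8 * (a * (p + q + 9)) ^ 8         ≡⟨ cong (2 * 3 ^ 8 *_) (^-distribʳ-* a (p + q + 9) 8) ⟩
        2 * 3 ^ 8 * (a ^ 8 * (p + q + 9) ^ 8)     ≡⟨ e₂ (3 ^ 8) (a ^ 8) ((p + q + 9) ^ 8) ⟩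
        3 ^ 8 * a ^ 8 * (2 * (p + q + 9) ^ 8)     ≡⟨ cong (_* (2 * (p + q + 9) ^ 8)) (^-distribʳ-* 3 a 8) ⟨
        (3 * a) ^ 8 * (2 * (p + q + 9) ^ 8)       ∎
      nonzero : NonZero (2 ^ q * (3 ^ 8 * 8 ^ 8))
      nonzero = m*n≢0 (2 ^ q) _ {{m^n≢0 2 q}}
      e₃ : ∀ x y t e → 2 * x * (y * (t * e)) ≡ 2 * t * (x * y * e)
      e₃ = solve-∀
      collect : 2 ^ suc p * (2 ^ q * (3 ^ 8 * 8 ^ 8)) ≡ 2 * 3 ^ 8 * (2 ^ (p + q) * 8 ^ 8)
      collect = trans (e₃ (2 ^ p) (2 ^ q) (3 ^ 8) (8 ^ 8))
                      (cong (λ y → 2 * 3 ^ 8 * (y * 8 ^ 8)) (sym (^-distribˡ-+-* 2 p q)))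

    growth : ∀ r → ((p + q + r + 1) * a + 8) ^ 8 < 2 ^ (p + q + r) * 8 ^ 8
    growth zero    = subst (λ t → ((t + 1) * a + 8) ^ 8 < 2 ^ t * 8 ^ 8) (sym (+-identityʳ (p + q))) growth-base
    growth (suc r) = begin-strict
      ((p + q + suc r + 1) * a + 8) ^ 8   ≡⟨ cong (_^ 8) (e (p + q) r a) ⟩
      (x + a) ^ 8                          ≤⟨ [n+a]^k≤2*n^k a x 8 {{x≢0}} 16a≤x ⟩
      2 * x ^ 8                            <⟨ *-monoʳ-< 2 (growth r) ⟩
      2 * (2 ^ t * 8 ^ 8)                  ≡⟨ *-assoc 2 (2 ^ t) (8 ^ 8) ⟨
      2 ^ suc t * 8 ^ 8                    ≡⟨ cong (λ t → 2 ^ t * 8 ^ 8) (+-suc (p + q) r) ⟨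
      2 ^ (p + q + suc r) * 8 ^ 8          ∎
      where
      open ≤-Reasoning
      t x : ℕ
      t = p + q + r
      x = (t + 1) * a + 8
      e : ∀ s r a → (s + suc r + 1) * a + 8 ≡ (s + r + 1) * a + 8 + a
      e = solve-∀
      x≢0 : NonZero x
      x≢0 = >-nonZero (≤-trans (s≤s z≤n) (m≤n+m 8 _))
      16a≤x : 2 * (8 * a) ≤ x
      16a≤x = 16a≤[t+1]a+8 t (>-nonZero⁻¹ a) [3a]^8<2^[1+p] (≤-trans (m≤m+n p q) (m≤m+n (p + q) r))

    below-p+q : ∀ t → 2 ^ t * 8 ^ 8 ≤ ((t + 1) * a + 8) ^ 8 → t < p + q
    below-p+q t 2^t8⁸≤x⁸ with t <? p + q
    ... | yes t<p+q = t<p+q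
    ... | no  t≮p+q = contradiction 2^t8⁸≤x⁸ (<⇒≱ (subst (λ t → ((t + 1) * a + 8) ^ 8 < 2 ^ t * 8 ^ 8)
                                                        (m+[n∸m]≡n (≮⇒≥ t≮p+q)) (growth (t ∸ (p + q)))))

  scaled-power-bound : ∀ m s a t .{{_ : NonZero m}} → t * m ≤ 8 * s → 8 * s ≤ m * (t + 1) →
                       m ^ m * 2 ^ s ≤ (s * a + m) ^ m → 2 ^ t * 8 ^ 8 ≤ ((t + 1) * a + 8) ^ 8
  scaled-power-bound m s a t tm≤8s 8s≤m[t+1] mᵐ2ˢ≤[sa+m]ᵐ = *-cancelˡ-≤ (m ^ 8) {{m^n≢0 m 8}} (begin
    m ^ 8 * (2 ^ t * 8 ^ 8)     ≡⟨ *-assoc (m ^ 8) (2 ^ t) (8 ^ 8) ⟨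
    m ^ 8 * 2 ^ t * 8 ^ 8       ≤⟨ *-monoˡ-≤ (8 ^ 8) m⁸2ᵗ≤[sa+m]⁸ ⟩
    (s * a + m) ^ 8 * 8 ^ 8     ≡⟨ trans (*-comm ((s * a + m) ^ 8) (8 ^ 8)) (sym (^-distribʳ-* 8 (s * a + m) 8)) ⟩
    (8 * (s * a + m)) ^ 8       ≤⟨ ^-monoˡ-≤ 8 8[sa+m]≤mx ⟩
    (m * x) ^ 8                 ≡⟨ ^-distribʳ-* m x 8 ⟩
    m ^ 8 * x ^ 8               ∎)
    where
    open ≤-Reasoning
    x : ℕ
    x = (t + 1) * a + 8
    [m⁸2ᵗ]ᵐ≤[mᵐ2ˢ]⁸ : (m ^ 8 * 2 ^ t) ^ m ≤ (m ^ m * 2 ^ s) ^ 8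
    [m⁸2ᵗ]ᵐ≤[mᵐ2ˢ]⁸ = begin
      (m ^ 8 * 2 ^ t) ^ m        ≡⟨ ^-distribʳ-* (m ^ 8) (2 ^ t) m ⟩
      (m ^ 8) ^ m * (2 ^ t) ^ m  ≡⟨ cong₂ _*_ (^-*-assoc m 8 m) (^-*-assoc 2 t m) ⟩
      m ^ (8 * m) * 2 ^ (t * m)  ≤⟨ *-mono-≤ (≤-reflexive (cong (m ^_) (*-comm 8 m))) (^-monoʳ-≤ 2 tm≤8s) ⟩
      m ^ (m * 8) * 2 ^ (8 * s)  ≡⟨ cong (m ^ (m * 8) *_) (cong (2 ^_) (*-comm 8 s)) ⟩
      m ^ (m * 8) * 2 ^ (s * 8)  ≡⟨ cong₂ _*_ (^-*-assoc m m 8) (^-*-assoc 2 s 8) ⟨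
      (m ^ m) ^ 8 * (2 ^ s) ^ 8  ≡⟨ ^-distribʳ-* (m ^ m) (2 ^ s) 8 ⟨
      (m ^ m * 2 ^ s) ^ 8        ∎
    [[sa+m]ᵐ]⁸≡[[sa+m]⁸]ᵐ : ((s * a + m) ^ m) ^ 8 ≡ ((s * a + m) ^ 8) ^ m
    [[sa+m]ᵐ]⁸≡[[sa+m]⁸]ᵐ = trans (^-*-assoc (s * a + m) m 8)
                              (trans (cong ((s * a + m) ^_) (*-comm m 8)) (sym (^-*-assoc (s * a + m) 8 m)))
    m⁸2ᵗ≤[sa+m]⁸ : m ^ 8 * 2 ^ t ≤ (s * a + m) ^ 8
    m⁸2ᵗ≤[sa+m]⁸ = ^-cancelˡ-≤ m (≤-trans [m⁸2ᵗ]ᵐ≤[mᵐ2ˢ]⁸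
                                   (≤-trans (^-monoˡ-≤ 8 mᵐ2ˢ≤[sa+m]ᵐ) (≤-reflexive [[sa+m]ᵐ]⁸≡[[sa+m]⁸]ᵐ)))
    e₁ : ∀ s a m → 8 * (s * a + m) ≡ 8 * s * a + 8 * m
    e₁ = solve-∀
    e₂ : ∀ m t a → m * ((t + 1) * a + 8) ≡ m * (t + 1) * a + 8 * m
    e₂ = solve-∀
    8[sa+m]≤mx : 8 * (s * a + m) ≤ m * x
    8[sa+m]≤mx = subst₂ _≤_ (sym (e₁ s a m)) (sym (e₂ m t a)) (+-monoˡ-≤ (8 * m) (*-monoˡ-≤ a 8s≤m[t+1]))

  power-bound⇒BoundLog : ∀ m s a .{{_ : NonZero m}} .{{_ : NonZero a}} →
                         m ^ m * 2 ^ s ≤ (s * a + m) ^ m → BoundLog s m a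
  power-bound⇒BoundLog m s a mᵐ2ˢ≤[sa+m]ᵐ r₁ r₂ _ r₁<sr₂
    with p , 2^p≤[3a]^8 , [3a]^8<2^[1+p] ← ⌊log₂⌋-spec ((3 * a) ^ 8) {{m^n≢0 (3 * a) 8 {{m*n≢0 3 a}}}}
    with q , 2^q²≤a^64 , a^64<2^[1+q]² ← ⌊√log₂⌋-spec (a ^ 64) {{m^n≢0 a 64}}
    = p , 8 , q , 8 , s≤s z≤n , s≤s z≤n , 2^p≤[3a]^8 , 2^q²≤a^64 , r₁·64<m·r₂·8[p+q]
    where
    open Growth {a} {p} {q} 2^p≤[3a]^8 [3a]^8<2^[1+p] a^64<2^[1+q]²
    t : ℕ
    t = 8 * s / m
    8s<m[t+1] : 8 * s < m * (t + 1)
    8s<m[t+1] = subst₂ _<_ (sym (m≡m%n+[m/n]*n (8 * s) m)) (e m t) (+-monoˡ-< (t * m) (m%n<n (8 * s) m))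
      where
      e : ∀ m t → m + t * m ≡ m * (t + 1)
      e = solve-∀
    8s≤m[p+q] : 8 * s ≤ m * (p + q)
    8s≤m[p+q] = ≤-trans (<⇒≤ 8s<m[t+1]) (*-monoʳ-≤ m (subst (_≤ p + q) (+-comm 1 t)
                  (below-p+q t (scaled-power-bound m s a t (m/n*n≤m (8 * s) m) (<⇒≤ 8s<m[t+1]) mᵐ2ˢ≤[sa+m]ᵐ))))
    e₁ : ∀ s r → s * r * 8 * 8 ≡ 8 * s * (r * 8)
    e₁ = solve-∀
    e₂ : ∀ m r p q → m * (p + q) * (r * 8) ≡ m * r * (p * 8 + q * 8)
    e₂ = solve-∀
    r₁·64<m·r₂·8[p+q] : r₁ * 8 * 8 < m * r₂ * (p * 8 + q * 8)
    r₁·64<m·r₂·8[p+q] = <-≤-trans (*-monoˡ-< 8 (*-monoˡ-< 8 r₁<sr₂))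
                          (subst₂ _≤_ (sym (e₁ s r₂)) (e₂ m r₂ p q) (*-monoˡ-≤ (r₂ * 8) 8s≤m[p+q]))

module Encodings where
  open FiniteSums using (prodℕ)
  open import Data.Nat as ℕ using (ℕ; zero; suc; _≤_; _^_; s≤s)
  open import Data.Fin as Fin using (Fin; zero; suc; fromℕ<; combine; remQuot)
  import Data.Fin.Properties as Fin
  open import Data.Bool using (Bool; true; false; if_then_else_)
  open import Data.Product using (_×_; _,_; proj₁; proj₂; uncurry)
  open import Function using (_∘_; Inverse)
  open import Relation.Nullary using (Dec; yes; no; does)
  open import Relation.Binary.PropositionalEquality

  open Inverse Fin.2↔Bool using () renaming (to to bit; from to unbit; strictlyInverseʳ to unbit-bit)

  bit-injective : ∀ {i j} → bit i ≡ bit j → i ≡ j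
  bit-injective {i} {j} eq = trans (sym (unbit-bit i)) (trans (cong unbit eq) (unbit-bit j))

  -- The subset of supp x whose characteristic bits, along supp x, are the binary digits of the index.
  subset : ∀ {n} (x : Fin n → ℕ) → Fin (2 ^ suppSize x) → Fin n → Bool
  subset′ : ∀ {n} (x : Fin (suc n) → ℕ) (x₀≟0 : Dec (x zero ≡ 0)) →
            Fin (2 ^ ((if does x₀≟0 then 0 else 1) ℕ.+ suppSize (x ∘ suc))) → Fin (suc n) → Bool
  subset {zero}  x i ()
  subset {suc n} x i = subset′ x (x zero ℕ.≟ 0) i
  subset′ x (yes _) i zero    = false
  subset′ x (yes _) i (suc l) = subset (x ∘ suc) i l
  subset′ x (no _)  i zero    = bit (proj₁ (remQuot {2} (2 ^ suppSize (x ∘ suc)) i))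
  subset′ x (no _)  i (suc l) = subset (x ∘ suc) (proj₂ (remQuot {2} (2 ^ suppSize (x ∘ suc)) i)) l

  subset-⊆-supp : ∀ {n} (x : Fin n → ℕ) i l → subset x i l ≡ true → x l ≢ 0
  subset′-⊆-supp : ∀ {n} (x : Fin (suc n) → ℕ) x₀≟0 i l → subset′ x x₀≟0 i l ≡ true → x l ≢ 0
  subset-⊆-supp {suc n} x i l = subset′-⊆-supp x (x zero ℕ.≟ 0) i l
  subset′-⊆-supp x (yes _)    i (suc l) = subset-⊆-supp (x ∘ suc) i l
  subset′-⊆-supp x (no x₀≢0) i zero    _ = x₀≢0
  subset′-⊆-supp x (no _)     i (suc l) = subset-⊆-supp (x ∘ suc) (proj₂ (remQuot {2} (2 ^ suppSize (x ∘ suc)) i)) l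

  subset-injective : ∀ {n} (x : Fin n → ℕ) i i′ → (∀ l → subset x i l ≡ subset x i′ l) → i ≡ i′
  subset′-injective : ∀ {n} (x : Fin (suc n) → ℕ) x₀≟0 i i′ → (∀ l → subset′ x x₀≟0 i l ≡ subset′ x x₀≟0 i′ l) → i ≡ i′
  subset-injective {zero}  x zero zero _ = refl
  subset-injective {suc n} x i i′ same = subset′-injective x (x zero ℕ.≟ 0) i i′ same
  subset′-injective x (yes _) i i′ same = subset-injective (x ∘ suc) i i′ (same ∘ suc)
  subset′-injective x (no _)  i i′ same = begin
    i                                   ≡⟨ Fin.combine-remQuot {2} k i ⟨
    uncurry combine (remQuot {2} k i)   ≡⟨ cong (uncurry combine) (cong₂ _,_ (bit-injective (same zero)) same-rest) ⟩
    uncurry combine (remQuot {2} k i′)  ≡⟨ Fin.combine-remQuot {2} k i′ ⟩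
    i′                                  ∎
    where
    open ≡-Reasoning
    k : ℕ
    k = 2 ^ suppSize (x ∘ suc)
    same-rest : proj₂ (remQuot {2} k i) ≡ proj₂ (remQuot {2} k i′)
    same-rest = subset-injective (x ∘ suc) (proj₂ (remQuot {2} k i)) (proj₂ (remQuot {2} k i′)) (same ∘ suc)

  encode : ∀ {m} (R v : Fin m → ℕ) → (∀ i → v i ≤ R i) → Fin (prodℕ (suc ∘ R))
  encode {zero}  R v v≤R = zero
  encode {suc m} R v v≤R = combine (fromℕ< (s≤s (v≤R zero))) (encode (R ∘ suc) (v ∘ suc) (v≤R ∘ suc))

  encode-injective : ∀ {m} (R v w : Fin m → ℕ) v≤R w≤R → encode R v v≤R ≡ encode R w w≤R → ∀ i → v i ≡ w i
  encode-injective {suc m} R v w v≤R w≤R same = λ where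
      zero    → Fin.fromℕ<-injective (v zero) (w zero) (s≤s (v≤R zero)) (s≤s (w≤R zero)) (proj₁ parts)
      (suc i) → encode-injective (R ∘ suc) (v ∘ suc) (w ∘ suc) (v≤R ∘ suc) (w≤R ∘ suc) (proj₂ parts) i
    where
    parts : fromℕ< (s≤s (v≤R zero)) ≡ fromℕ< (s≤s (w≤R zero))
          × encode (R ∘ suc) (v ∘ suc) (v≤R ∘ suc) ≡ encode (R ∘ suc) (w ∘ suc) (w≤R ∘ suc)
    parts = Fin.combine-injective _ _ _ _ same

module Indicators where
  open import Data.Nat as ℕ using (ℕ; zero; suc; _≤_; _<_; z≤n; s≤s)
  import Data.Nat.Properties as ℕ
  open import Data.Integer as ℤ using (ℤ; +_; -[1+_]; _*_; _-_; ∣_∣)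
  import Data.Integer.Properties as ℤ
  open import Data.Integer.Tactic.RingSolver using (solve-∀)
  open import Data.Bool using (Bool; true; false; if_then_else_)
  open import Relation.Nullary using (does; contradiction)
  open import Relation.Binary.PropositionalEquality

  𝟙 : Bool → ℕ
  𝟙 true  = 1
  𝟙 false = 0

  _⁺ _⁻ : ℤ → ℕ
  (+ k) ⁺    = k
  -[1+ k ] ⁺ = 0
  (+ k) ⁻    = 0
  -[1+ k ] ⁻ = suc k

  part : Bool → ℤ → ℕ
  part true  z = z ⁺
  part false z = z ⁻

  part≤∣∣ : ∀ s z → part s z ≤ ∣ z ∣
  part≤∣∣ true  (+ k)    = ℕ.≤-refl
  part≤∣∣ true  -[1+ k ] = z≤n
  part≤∣∣ false (+ k)    = z≤n
  part≤∣∣ false -[1+ k ] = ℕ.≤-refl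

  ⁺-⁻ : ∀ z → + z ⁺ - + z ⁻ ≡ z
  ⁺-⁻ (+ k)    = ℤ.+-identityʳ (+ k)
  ⁺-⁻ -[1+ k ] = refl

  part-difference : ∀ z s s′ → z * (+ 𝟙 s - + 𝟙 s′) ≡ + part s z - + part s′ z
  part-difference z true  true  = trans (ℤ.*-zeroʳ z) (sym (ℤ.+-inverseʳ (+ z ⁺)))
  part-difference z false false = trans (ℤ.*-zeroʳ z) (sym (ℤ.+-inverseʳ (+ z ⁻)))
  part-difference z true  false = trans (ℤ.*-identityʳ z) (sym (⁺-⁻ z))
  part-difference z false true  = trans (cong (_* (+ 0 - + 1)) (sym (⁺-⁻ z))) (negate (+ z ⁺) (+ z ⁻))
    where
    negate : ∀ p q → (p - q) * (+ 0 - + 1) ≡ q - p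
    negate = solve-∀

  [≢0] : ℕ → ℕ
  [≢0] u = if does (u ℕ.≟ 0) then 0 else 1

  [≢0]-mono : ∀ {u v} → (u ≡ 0 → v ≡ 0) → [≢0] v ≤ [≢0] u
  [≢0]-mono {zero}  {zero}  _    = z≤n
  [≢0]-mono {zero}  {suc v} v⊆u  = contradiction (v⊆u refl) λ ()
  [≢0]-mono {suc u} {zero}  _    = z≤n
  [≢0]-mono {suc u} {suc v} _    = s≤s z≤n

  [≢0]-< : ∀ {u v} → u ≢ 0 → v ≡ 0 → [≢0] v < [≢0] u
  [≢0]-< {zero}  u≢0 _    = contradiction refl u≢0
  [≢0]-< {suc u} _   refl = s≤s z≤n

module Supports {n : ℕ} where
  open FiniteSums
  open Indicators using (𝟙; [≢0]; [≢0]-mono; [≢0]-<)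
  open import Data.Nat as ℕ using (ℕ; _≤_; _<_; z≤n; _∸_)
  import Data.Nat.Properties as ℕ
  open import Data.Integer as ℤ using (ℤ; +_; -_; _+_; _-_)
  import Data.Integer.Properties as ℤ
  open import Data.Integer.Tactic.RingSolver using (solve-∀)
  open import Data.Fin using (Fin)
  open import Data.Bool using (Bool; true; false; if_then_else_)
  open import Relation.Nullary using (does; contradiction)
  open import Relation.Binary.PropositionalEquality

  suppSize-mono-≤ : ∀ {x y : Fin n → ℕ} → (∀ j → x j ≡ 0 → y j ≡ 0) → suppSize y ≤ suppSize x
  suppSize-mono-≤ y⊆x = sumℕ-mono-≤ (λ j → [≢0]-mono (y⊆x j))

  suppSize-mono-< : ∀ {x y : Fin n → ℕ} → (∀ j → x j ≡ 0 → y j ≡ 0) → ∀ k → x k ≢ 0 → y k ≡ 0 →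
                    suppSize y < suppSize x
  suppSize-mono-< y⊆x k xk≢0 yk≡0 = sumℕ-mono-< (λ j → [≢0]-mono (y⊆x j)) k ([≢0]-< xk≢0 yk≡0)

  _⊆supp_ : (Fin n → Bool) → (Fin n → ℕ) → Set
  σ ⊆supp x = ∀ j → σ j ≡ true → x j ≢ 0

  𝟙≤ : ∀ {σ x} → σ ⊆supp x → ∀ j → 𝟙 (σ j) ≤ x j
  𝟙≤ {σ} {x} σ⊆x j with σ j in σj
  ... | true  = ℕ.n≢0⇒n>0 (σ⊆x j σj)
  ... | false = z≤n

  ∉supp : ∀ {σ x} → σ ⊆supp x → ∀ j → x j ≡ 0 → σ j ≡ false
  ∉supp {σ} σ⊆x j xj≡0 with σ j in σj
  ... | true  = contradiction xj≡0 (σ⊆x j σj)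
  ... | false = refl

  δ : (σ σ′ : Fin n → Bool) → Fin n → ℤ
  δ σ σ′ j = + 𝟙 (σ j) - + 𝟙 (σ′ j)

  step back : (Fin n → ℕ) → (σ σ′ : Fin n → Bool) → Fin n → ℕ
  step x σ σ′ j = x j ∸ 𝟙 (σ j) ℕ.+ 𝟙 (σ′ j)
  back x σ σ′ j = x j ℕ.+ 𝟙 (σ j) ∸ 𝟙 (σ′ j)

  pos-∸ : ∀ {u v} → v ≤ u → + (u ∸ v) ≡ + u - + v
  pos-∸ {u} {v} v≤u = sym (trans (ℤ.m-n≡m⊖n u v) (ℤ.⊖-≥ v≤u))

  step-≡ : ∀ {x σ} σ′ → σ ⊆supp x → ∀ j → + step x σ σ′ j ≡ + x j - δ σ σ′ j
  step-≡ {x} {σ} σ′ σ⊆x j = begin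
    + (x j ∸ 𝟙 (σ j) ℕ.+ 𝟙 (σ′ j))        ≡⟨ ℤ.pos-+ (x j ∸ 𝟙 (σ j)) (𝟙 (σ′ j)) ⟩
    + (x j ∸ 𝟙 (σ j)) + + 𝟙 (σ′ j)        ≡⟨ cong (_+ + 𝟙 (σ′ j)) (pos-∸ (𝟙≤ σ⊆x j)) ⟩
    + x j - + 𝟙 (σ j) + + 𝟙 (σ′ j)        ≡⟨ regroup (+ x j) (+ 𝟙 (σ j)) (+ 𝟙 (σ′ j)) ⟩
    + x j - (+ 𝟙 (σ j) - + 𝟙 (σ′ j))      ∎
    where
    open ≡-Reasoning
    regroup : ∀ u s t → u - s + t ≡ u - (s - t)
    regroup = solve-∀

  back-≡ : ∀ {x σ′} σ → σ′ ⊆supp x → ∀ j → + back x σ σ′ j ≡ + x j + δ σ σ′ j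
  back-≡ {x} {σ′} σ σ′⊆x j = begin
    + (x j ℕ.+ 𝟙 (σ j) ∸ 𝟙 (σ′ j))        ≡⟨ pos-∸ (ℕ.≤-trans (𝟙≤ σ′⊆x j) (ℕ.m≤m+n (x j) (𝟙 (σ j)))) ⟩
    + (x j ℕ.+ 𝟙 (σ j)) - + 𝟙 (σ′ j)      ≡⟨ cong (_- + 𝟙 (σ′ j)) (ℤ.pos-+ (x j) (𝟙 (σ j))) ⟩
    + x j + + 𝟙 (σ j) - + 𝟙 (σ′ j)        ≡⟨ ℤ.+-assoc (+ x j) (+ 𝟙 (σ j)) (- + 𝟙 (σ′ j)) ⟩
    + x j + (+ 𝟙 (σ j) - + 𝟙 (σ′ j))      ∎
    where open ≡-Reasoning

  step-⊆supp : ∀ {x σ σ′} → σ ⊆supp x → σ′ ⊆supp x → ∀ j → x j ≡ 0 → step x σ σ′ j ≡ 0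
  step-⊆supp {x} {σ} {σ′} σ⊆x σ′⊆x j xj≡0
    rewrite ∉supp σ⊆x j xj≡0 | ∉supp σ′⊆x j xj≡0 | xj≡0 = refl

  masked : (Fin n → ℕ) → (Fin n → ℕ) → Fin n → ℕ
  masked x f j = if does (x j ℕ.≟ 0) then 0 else f j

module Exchange {m n : ℕ} (A : Matrix m n) (b : Fin m → ℤ) (c : Fin n → ℤ) where
  open FiniteSums
  open Indicators
  open Supports
  open Encodings
  open AMGM using (amgm)
  import Data.Fin.Properties as Fin
  import Data.Bool.Properties as Bool
  open import Function using (_∘_)
  open import Data.Nat as ℕ using (ℕ; zero; suc; _≤_; _<_; z≤n; _∸_; _^_)
  import Data.Nat.Properties as ℕ
  open import Data.Integer as ℤ using (ℤ; +_; -_; _+_; _*_; _-_; 0ℤ; ∣_∣)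
  import Data.Integer.Properties as ℤ
  open import Data.Integer.Tactic.RingSolver using (solve-∀)
  open import Data.Fin as Fin using (Fin)
  open import Data.Fin.Properties using (any?)
  open import Data.Bool using (Bool; true; false; if_then_else_)
  open import Data.Product using (∃-syntax; _×_; _,_)
  open import Relation.Nullary using (¬_; Dec; yes; no; does; ¬?; contradiction)
  open import Relation.Nullary.Decidable using (_×-dec_)
  open import Relation.Binary.PropositionalEquality

  Kernel : (Fin n → ℤ) → Set
  Kernel d = ∀ i → sumℤ (λ j → A i j * d j) ≡ 0ℤ

  feasible-translate : ∀ {x y} d → Feasible A b x → Kernel d → (∀ j → + y j ≡ + x j + d j) → Feasible A b y
  feasible-translate {x} {y} d Ax≡b Ad≡0 y≡x+d i = begin
    mulVec A y i                                    ≡⟨ sumℤ-*-translate (A i) d y≡x+d ⟩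
    mulVec A x i + sumℤ (λ j → A i j * d j)         ≡⟨ cong₂ _+_ (Ax≡b i) (Ad≡0 i) ⟩
    b i + 0ℤ                                        ≡⟨ ℤ.+-identityʳ (b i) ⟩
    b i                                             ∎
    where open ≡-Reasoning

  kernel-neg : ∀ {d} → Kernel d → Kernel (λ j → - d j)
  kernel-neg {d} Ad≡0 i = trans (sumℤ-*-neg (A i) d) (cong -_ (Ad≡0 i))

  -- If both x - d and x + d are feasible, optimality of x forces c·d = 0.
  optimal-exchange : ∀ {x y z} d → Optimal A b c x → Kernel d →
                     (∀ j → + y j ≡ + x j - d j) → (∀ j → + z j ≡ + x j + d j) → Optimal A b c y
  optimal-exchange {x} {y} {z} d (Ax≡b , x-max) Ad≡0 y≡x-d z≡x+d =
    feasible-translate (λ j → - d j) Ax≡b (kernel-neg Ad≡0) y≡x-d , λ w Aw≡b → ℤ.≤-trans (x-max w Aw≡b) cx≤cy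
    where
    cd : ℤ
    cd = sumℤ (λ j → c j * d j)
    cz≤cx : dot c x + cd ℤ.≤ dot c x
    cz≤cx = subst (ℤ._≤ dot c x) (sumℤ-*-translate c d z≡x+d) (x-max z (feasible-translate d Ax≡b Ad≡0 z≡x+d))
    cancel : ∀ a e → a - (a + e) ≡ - e
    cancel = solve-∀
    0≤-cd : 0ℤ ℤ.≤ - cd
    0≤-cd = subst (0ℤ ℤ.≤_) (cancel (dot c x) cd) (ℤ.i≤j⇒0≤j-i cz≤cx)
    cx≤cy : dot c x ℤ.≤ dot c y
    cx≤cy = subst₂ ℤ._≤_ (ℤ.+-identityʳ (dot c x))
              (sym (trans (sumℤ-*-translate c (λ j → - d j) y≡x-d) (cong (_+_ (dot c x)) (sumℤ-*-neg c d))))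
              (ℤ.+-monoʳ-≤ (dot c x) 0≤-cd)

  step-optimal : ∀ {x σ σ′} → Optimal A b c x → σ ⊆supp x → σ′ ⊆supp x → Kernel (δ σ σ′) →
                 Optimal A b c (step x σ σ′)
  step-optimal {σ = σ} {σ′} opt σ⊆x σ′⊆x ker = optimal-exchange (δ σ σ′) opt ker (step-≡ σ′ σ⊆x) (back-≡ σ σ′⊆x)

  module _ {σ σ′ : Fin n → Bool} (ker : Kernel (δ σ σ′))
           {j₀ : Fin n} (σj₀ : σ j₀ ≡ true) (σ′j₀ : σ′ j₀ ≡ false) where

    -- Step along -δ σ σ′ until a coordinate leaves the support; x j₀ decreases at every step.
    reduce-support : ∀ k x → Optimal A b c x → σ ⊆supp x → σ′ ⊆supp x → x j₀ ≤ k →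
                     ∃[ x′ ] (Optimal A b c x′ × suppSize x′ < suppSize x)
    reduce-support zero    x _   σ⊆x _    xj₀≤0 = contradiction (ℕ.n≤0⇒n≡0 xj₀≤0) (σ⊆x j₀ σj₀)
    reduce-support (suc k) x opt σ⊆x σ′⊆x xj₀≤1+k = reduce (any? (λ j → (y j ℕ.≟ 0) ×-dec ¬? (x j ℕ.≟ 0)))
      where
      y : Fin n → ℕ
      y = step x σ σ′
      opt-y : Optimal A b c y
      opt-y = step-optimal opt σ⊆x σ′⊆x ker
      y⊆x : ∀ j → x j ≡ 0 → y j ≡ 0
      y⊆x = step-⊆supp σ⊆x σ′⊆x
      yj₀≤k : y j₀ ≤ k
      yj₀≤k rewrite σj₀ | σ′j₀ = subst (_≤ k) (sym (ℕ.+-identityʳ (x j₀ ∸ 1))) (ℕ.∸-monoˡ-≤ 1 xj₀≤1+k)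
      stays : ¬ (∃[ j ] (y j ≡ 0 × x j ≢ 0)) → ∀ {τ} → τ ⊆supp x → τ ⊆supp y
      stays nothing-leaves τ⊆x j τj yj≡0 = nothing-leaves (j , yj≡0 , τ⊆x j τj)
      reduce : Dec (∃[ j ] (y j ≡ 0 × x j ≢ 0)) → ∃[ x′ ] (Optimal A b c x′ × suppSize x′ < suppSize x)
      reduce (yes (j , yj≡0 , xj≢0)) = y , opt-y , suppSize-mono-< y⊆x j xj≢0 yj≡0
      reduce (no nothing-leaves)
        with reduce-support k y opt-y (stays nothing-leaves σ⊆x) (stays nothing-leaves σ′⊆x) yj₀≤k
      ... | x′ , opt′ , x′<y = x′ , opt′ , ℕ.<-≤-trans x′<y (suppSize-mono-≤ y⊆x)

  weight : (Fin n → ℕ) → (Fin n → Bool) → Fin m → ℕ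
  weight x σ i = sumℕ (masked x (λ j → part (σ j) (A i j)))

  row-bound : (Fin n → ℕ) → Fin m → ℕ
  row-bound x i = sumℕ (masked x (λ j → ∣ A i j ∣))

  weight≤row-bound : ∀ x σ i → weight x σ i ≤ row-bound x i
  weight≤row-bound x σ i = sumℕ-mono-≤ (λ j → masked-mono (x j) (part≤∣∣ (σ j) (A i j)))
    where
    masked-mono : ∀ u {p q} → p ≤ q → (if does (u ℕ.≟ 0) then 0 else p) ≤ (if does (u ℕ.≟ 0) then 0 else q)
    masked-mono zero    _   = z≤n
    masked-mono (suc u) p≤q = p≤q

  -- A (𝟙σ - 𝟙σ′) is the difference of the two weight vectors.
  kernel-of-equal-weights : ∀ {x σ σ′} → σ ⊆supp x → σ′ ⊆supp x → (∀ i → weight x σ i ≡ weight x σ′ i) →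
                            Kernel (δ σ σ′)
  kernel-of-equal-weights {x} {σ} {σ′} σ⊆x σ′⊆x same i = begin
    sumℤ (λ j → A i j * δ σ σ′ j)                               ≡⟨ sumℤ-cong pointwise ⟩
    sumℤ (λ j → + w σ j - + w σ′ j)                             ≡⟨ sumℤ-distrib-+ (λ j → + w σ j) (λ j → - + w σ′ j) ⟩
    sumℤ (λ j → + w σ j) + sumℤ (λ j → - + w σ′ j)              ≡⟨ cong₂ _+_ (sumℤ-pos (w σ))
                                                                     (trans (sumℤ-neg (λ j → + w σ′ j)) (cong -_ (sumℤ-pos (w σ′)))) ⟩
    + weight x σ i - + weight x σ′ i                             ≡⟨ cong (λ v → + v - + weight x σ′ i) (same i) ⟩
    + weight x σ′ i - + weight x σ′ i                            ≡⟨ ℤ.+-inverseʳ (+ weight x σ′ i) ⟩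
    0ℤ                                                           ∎
    where
    open ≡-Reasoning
    w : (Fin n → Bool) → Fin n → ℕ
    w τ = masked x (λ j → part (τ j) (A i j))
    masked-difference : ∀ u s s′ z → (u ≡ 0 → s ≡ false) → (u ≡ 0 → s′ ≡ false) →
      z * (+ 𝟙 s - + 𝟙 s′) ≡ + (if does (u ℕ.≟ 0) then 0 else part s z) - + (if does (u ℕ.≟ 0) then 0 else part s′ z)
    masked-difference zero    s s′ z s≡false s′≡false rewrite s≡false refl | s′≡false refl = ℤ.*-zeroʳ z
    masked-difference (suc u) s s′ z _ _ = part-difference z s s′
    pointwise : ∀ j → A i j * δ σ σ′ j ≡ + w σ j - + w σ′ j
    pointwise j = masked-difference (x j) (σ j) (σ′ j) (A i j) (∉supp σ⊆x j) (∉supp σ′⊆x j)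

  record Collision (x : Fin n → ℕ) : Set where
    field
      σ σ′        : Fin n → Bool
      σ⊆x         : σ ⊆supp x
      σ′⊆x        : σ′ ⊆supp x
      same-weight : ∀ i → weight x σ i ≡ weight x σ′ i
      j₀          : Fin n
      σj₀         : σ j₀ ≡ true
      σ′j₀        : σ′ j₀ ≡ false

  collision-at : ∀ {x} τ τ′ → τ ⊆supp x → τ′ ⊆supp x → (∀ i → weight x τ i ≡ weight x τ′ i) →
                 ∀ l → τ l ≢ τ′ l → Collision x
  collision-at τ τ′ τ⊆x τ′⊆x same l τl≢τ′l with τ l in τl | τ′ l in τ′l
  ... | true  | true  = contradiction refl τl≢τ′l
  ... | false | false = contradiction refl τl≢τ′l
  ... | true  | false = record { σ = τ ; σ′ = τ′ ; σ⊆x = τ⊆x ; σ′⊆x = τ′⊆x ; same-weight = same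
                               ; j₀ = l ; σj₀ = τl ; σ′j₀ = τ′l }
  ... | false | true  = record { σ = τ′ ; σ′ = τ ; σ⊆x = τ′⊆x ; σ′⊆x = τ⊆x ; same-weight = sym ∘ same
                               ; j₀ = l ; σj₀ = τ′l ; σ′j₀ = τl }

  weight-code : ∀ x → Fin (2 ^ suppSize x) → Fin (prodℕ (suc ∘ row-bound x))
  weight-code x ι = encode (row-bound x) (weight x (subset x ι)) (weight≤row-bound x (subset x ι))

  -- Pigeonhole: 2 ^ |supp x| subsets of supp x, but fewer possible weight vectors.
  collision : ∀ x → prodℕ (suc ∘ row-bound x) < 2 ^ suppSize x → Collision x
  collision x few-weights
    with ι , ι′ , ι<ι′ , same-code ← Fin.pigeonhole few-weights (weight-code x)
    with l , differ ← Fin.¬∀⟶∃¬ n _ (λ l → subset x ι l Bool.≟ subset x ι′ l)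
                        (λ same → ℕ.<-irrefl (cong Fin.toℕ (subset-injective x ι ι′ same)) ι<ι′)
    = collision-at (subset x ι) (subset x ι′) (subset-⊆-supp x ι) (subset-⊆-supp x ι′)
                   (encode-injective (row-bound x) _ _ _ _ same-code) l differ

  shrink : ∀ {x} → Optimal A b c x → prodℕ (suc ∘ row-bound x) < 2 ^ suppSize x →
           ∃[ x′ ] (Optimal A b c x′ × suppSize x′ < suppSize x)
  shrink {x} opt few-weights =
    reduce-support (kernel-of-equal-weights σ⊆x σ′⊆x same-weight) σj₀ σ′j₀ (x j₀) x opt σ⊆x σ′⊆x ℕ.≤-refl
    where open Collision (collision x few-weights)

  descend : ∀ k x → Optimal A b c x → suppSize x ≤ k →
            ∃[ x⋆ ] (Optimal A b c x⋆ × 2 ^ suppSize x⋆ ≤ prodℕ (suc ∘ row-bound x⋆))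
  descend k x opt s≤k with prodℕ (suc ∘ row-bound x) ℕ.<? 2 ^ suppSize x
  descend k       x opt s≤k | no  many-weights = x , opt , ℕ.≮⇒≥ many-weights
  descend zero    x opt s≤0 | yes few-weights with shrink opt few-weights
  ... | _  , _    , x′<x = contradiction (ℕ.<-≤-trans x′<x s≤0) ℕ.n≮0
  descend (suc k) x opt s≤k | yes few-weights with shrink opt few-weights
  ... | x′ , opt′ , x′<x = descend k x′ opt′ (ℕ.≤-pred (ℕ.≤-trans x′<x s≤k))

  ∑row-bound≤suppSize*Amax : ∀ x → sumℕ (row-bound x) ≤ suppSize x ℕ.* Amax A
  ∑row-bound≤suppSize*Amax x = begin
    sumℕ (λ i → sumℕ (masked x (λ j → ∣ A i j ∣)))          ≡⟨ sumℕ-comm (λ i → masked x (λ j → ∣ A i j ∣)) ⟩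
    sumℕ (λ j → sumℕ (λ i → masked x (λ j → ∣ A i j ∣) j))  ≤⟨ sumℕ-mono-≤ (λ j → masked-column (x j) {λ i → A i j} (≤-maxℕ column-norm j)) ⟩
    sumℕ (λ j → [≢0] (x j) ℕ.* Amax A)                      ≡⟨ sumℕ-distribʳ-* (λ j → [≢0] (x j)) (Amax A) ⟩
    suppSize x ℕ.* Amax A                                    ∎
    where
    open ℕ.≤-Reasoning
    column-norm : Fin n → ℕ
    column-norm j = sumℕ (λ i → ∣ A i j ∣)
    masked-column : ∀ u {col : Fin m → ℤ} {a} → sumℕ (λ i → ∣ col i ∣) ≤ a →
                    sumℕ (λ i → if does (u ℕ.≟ 0) then 0 else ∣ col i ∣) ≤ [≢0] u ℕ.* a
    masked-column zero    _     = ℕ.≤-reflexive (sumℕ-zero m)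
    masked-column (suc u) col≤a = ℕ.≤-trans col≤a (ℕ.m≤m+n _ 0)

  optimum-power-bound : ∀ x → 2 ^ suppSize x ≤ prodℕ (suc ∘ row-bound x) →
                        m ^ m ℕ.* 2 ^ suppSize x ≤ (suppSize x ℕ.* Amax A ℕ.+ m) ^ m
  optimum-power-bound x many-weights = begin
    m ^ m ℕ.* 2 ^ suppSize x                    ≤⟨ ℕ.*-monoʳ-≤ (m ^ m) many-weights ⟩
    m ^ m ℕ.* prodℕ (suc ∘ row-bound x)         ≤⟨ amgm m (suc ∘ row-bound x) ⟩
    sumℕ (suc ∘ row-bound x) ^ m                ≡⟨ cong (_^ m) (sumℕ-suc (row-bound x)) ⟩
    (sumℕ (row-bound x) ℕ.+ m) ^ m              ≤⟨ ℕ.^-monoˡ-≤ m (ℕ.+-monoˡ-≤ m (∑row-bound≤suppSize*Amax x)) ⟩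
    (suppSize x ℕ.* Amax A ℕ.+ m) ^ m           ∎
    where open ℕ.≤-Reasoning

open FiniteSums using (maxℕ-zero)
open LogBound using (power-bound⇒BoundLog)
open import Data.Nat using (zero; suc; >-nonZero)
open import Data.Nat.Properties using (≤-refl)
open import Data.Product using (_,_)
open import Relation.Nullary using (contradiction)
open import Relation.Binary.PropositionalEquality using (subst)

theorem2 : (m n : ℕ) (A : Matrix m n) (b : Fin m → ℤ) (c : Fin n → ℤ) →
    1 ≤ Amax A →
    (∃[ x ] Optimal A b c x) →
    ∃[ xstar ] (Optimal A b c xstar × BoundLog (suppSize xstar) m (Amax A))
theorem2 zero    n A b c 1≤Amax _ = contradiction (subst (1 ≤_) (maxℕ-zero n) 1≤Amax) λ ()
theorem2 (suc m) n A b c 1≤Amax (x , opt)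
  with x⋆ , opt⋆ , many-weights ← Exchange.descend A b c (suppSize x) x opt ≤-refl
  = x⋆ , opt⋆ , power-bound⇒BoundLog (suc m) (suppSize x⋆) (Amax A) {{_}} {{>-nonZero 1≤Amax}}
                  (Exchange.optimum-power-bound A b c x⋆ many-weights)
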